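{- Let $S$ be a 3-SAT instance with $n$ variables and $m$ clauses and $G(S)$ the graph constructed from it as described in the context. Then $\operatorname{cdim}(G(S))\geq 2(m+n)$.
   Context: All graphs are finite, simple and undirected. For distinct vertices $v,w$, $\kappa(v,w)$ is the maximum number of internally vertex-disjoint $v$–$w$ paths; $\kappa(v,v)=\infty$. A set $W=\{w_1,\ldots,w_k\}$ is resolving if the vectors $[\kappa(v,w_1),\ldots,\kappa(v,w_k)]$, $v\in V(G)$, are pairwise distinct; $\operatorname{cdim}(G)$ is the minimum size of a resolving set. Construction: $S$ is a 3-SAT instance with variables $X_1,\ldots,X_n$ and clauses $C_1,\ldots,C_m$ (each clause a disjunction of literals $X_i$ or $\overline{X}_i$); every variable occurs in some clause. For each variable $X_i$ take vertices $x_i^1,\ldots,x_i^5$ with edges $x_i^1x_i^2, x_i^1x_i^3, x_i^1x_i^4, x_i^1x_i^5, x_i^2x_i^3, x_i^2x_i^4, x_i^2x_i^5, x_i^3x_i^4, x_i^3x_i^5$. For each clause $C_j$ take vertices $c_j^1,\ldots,c_j^6$ with edges $c_j^ac_j^b$ for $a\in\{1,2\}$, $b\in\{3,4,5\}$, edges $c_j^3c_j^4, c_j^3c_j^5, c_j^4c_j^5$, and $c_j^6c_j^3, c_j^6c_j^4, c_j^6c_j^5$. If $X_i$ occurs as a positive literal in $C_j$, add edges $c_j^1x_i^1, c_j^2x_i^1, c_j^2x_i^2$; if $X_i$ occurs as a negative literal in $C_j$, add edges $c_j^1x_i^1, c_j^1x_i^2, c_j^2x_i^2$. For every pair of distinct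 clauses $C_j\neq C_k$ add edges $c_j^1c_k^1, c_j^1c_k^2, c_j^2c_k^1, c_j^2c_k^2$. No other edges. The resulting graph is $G(S)$; it is assumed to be connected. -}

module Defs where

open import Data.Nat using (ℕ; suc)
open import Data.Fin using (Fin; zero; suc)
open import Data.Bool using (Bool; true; false)
open import Data.Product using (Σ; _×_; _,_)
open import Data.Sum using (_⊎_; inj₁; inj₂)
open import Data.Unit using (⊤)
open import Data.List using (List; []; _∷_; _++_; [_])
open import Data.List.Membership.Propositional using (_∈_; _∉_)
open import Data.List.Relation.Unary.Unique.Propositional using (Unique)
open import Data.Vec using (Vec)
import Data.Vec.Membership.Propositional as VM
open import Relation.Binary.PropositionalEquality using (_≡_; _≢_)
open import Relation.Nullary using (¬_)

module GraphNotions {V : Set} (Adj : V → V → Set) where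

  AdjChain : List V → Set
  AdjChain []           = ⊤
  AdjChain (x ∷ [])     = ⊤
  AdjChain (x ∷ y ∷ r)  = Adj x y × AdjChain (y ∷ r)

  IsPathVia : V → V → List V → Set
  IsPathVia v w mid = Unique (v ∷ mid ++ [ w ]) × AdjChain (v ∷ mid ++ [ w ])

  HasDisjointPaths : V → V → ℕ → Set
  HasDisjointPaths v w k =
    Σ (Fin k → List V) λ mids →
      (∀ i → IsPathVia v w (mids i)) ×
      (∀ i j → i ≢ j → (mids i ≢ mids j) × (∀ x → x ∈ mids i → x ∉ mids j))

  data ℕ∞ : Set where
    fin : ℕ → ℕ∞
    ∞   : ℕ∞

  Kappa : V → V → ℕ∞ → Set
  Kappa v w k =
      (v ≡ w × k ≡ ∞)
    ⊎ (v ≢ w × Σ ℕ λ c → k ≡ fin c × HasDisjointPaths v w c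
                         × ¬ HasDisjointPaths v w (suc c))

  Resolving : List V → Set
  Resolving W =
    ∀ u v → (∀ w → w ∈ W → ∀ a b → Kappa u w a → Kappa v w b → a ≡ b) → u ≡ v

  Connected : Set
  Connected = ∀ u v → u ≡ v ⊎ Σ (List V) λ mid → AdjChain (u ∷ mid ++ [ v ])

-- 3-SAT instances: literal (i , true) = X_i, (i , false) = ¬X_i

Literal : ℕ → Set
Literal n = Fin n × Bool

ThreeSAT : ℕ → ℕ → Set
ThreeSAT n m = Fin m → Vec (Literal n) 3

EveryVarOccurs : ∀ {n m} → ThreeSAT n m → Set
EveryVarOccurs {n} {m} S = ∀ (i : Fin n) → Σ (Fin m) λ j → Σ Bool λ b → (i , b) VM.∈ S j

-- vertices: inj₁ (i , a) = x_i^{a+1}, inj₂ (j , a) = c_j^{a+1}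
GV : ℕ → ℕ → Set
GV n m = (Fin n × Fin 5) ⊎ (Fin m × Fin 6)

-- Fin names (0-based): f0 = index of superscript 1, etc.
f0 : ∀ {k} → Fin (suc k)
f0 = zero
f1 : ∀ {k} → Fin (suc (suc k))
f1 = suc zero
f2 : ∀ {k} → Fin (suc (suc (suc k)))
f2 = suc (suc zero)
f3 : ∀ {k} → Fin (suc (suc (suc (suc k))))
f3 = suc (suc (suc zero))
f4 : ∀ {k} → Fin (suc (suc (suc (suc (suc k)))))
f4 = suc (suc (suc (suc zero)))
f5 : ∀ {k} → Fin (suc (suc (suc (suc (suc (suc k))))))
f5 = suc (suc (suc (suc (suc zero))))

data VarEdge : Fin 5 → Fin 5 → Set where
  e12 : VarEdge f0 f1
  e13 : VarEdge f0 f2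
  e14 : VarEdge f0 f3
  e15 : VarEdge f0 f4
  e23 : VarEdge f1 f2
  e24 : VarEdge f1 f3
  e25 : VarEdge f1 f4
  e34 : VarEdge f2 f3
  e35 : VarEdge f2 f4

data ClauseEdge : Fin 6 → Fin 6 → Set where
  c13 : ClauseEdge f0 f2
  c14 : ClauseEdge f0 f3
  c15 : ClauseEdge f0 f4
  c23 : ClauseEdge f1 f2
  c24 : ClauseEdge f1 f3
  c25 : ClauseEdge f1 f4
  c34 : ClauseEdge f2 f3
  c35 : ClauseEdge f2 f4
  c45 : ClauseEdge f3 f4
  c63 : ClauseEdge f5 f2
  c64 : ClauseEdge f5 f3
  c65 : ClauseEdge f5 f4

data LitEdge : Bool → Fin 6 → Fin 5 → Set where
  p11 : LitEdge true  f0 f0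
  p21 : LitEdge true  f1 f0
  p22 : LitEdge true  f1 f1
  n11 : LitEdge false f0 f0
  n12 : LitEdge false f0 f1
  n22 : LitEdge false f1 f1

data Top : Fin 6 → Set where
  t1 : Top f0
  t2 : Top f1

data Edge {n m : ℕ} (S : ThreeSAT n m) : GV n m → GV n m → Set where
  var    : ∀ i {a b} → VarEdge a b → Edge S (inj₁ (i , a)) (inj₁ (i , b))
  clause : ∀ j {a b} → ClauseEdge a b → Edge S (inj₂ (j , a)) (inj₂ (j , b))
  lit    : ∀ j i s {a b} → (i , s) VM.∈ S j → LitEdge s a b →
           Edge S (inj₂ (j , a)) (inj₁ (i , b))
  cc     : ∀ j k {a b} → j ≢ k → Top a → Top b →
           Edge S (inj₂ (j , a)) (inj₂ (k , b))

Adj : ∀ {n m} → ThreeSAT n m → GV n m → GV n m → Set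
Adj S u v = Edge S u v ⊎ Edge S v u

{-# OPTIONS --safe #-}
-- A resolving set W meets every variable gadget and every clause gadget in at least two
-- vertices; the m + n gadgets are disjoint, hence |W| ≥ 2(m + n).
-- Two vertices u, v with the same neighbours apart from each other (twins) are swapped by an
-- automorphism fixing every other vertex, so κ(u, w) = κ(v, w) for all w ∉ {u, v}, and W must
-- contain one of them. Now c³, c⁴, c⁵ are pairwise twins, and so are x⁴, x⁵. If W contains
-- only the leaf x^a of a variable gadget, it cannot separate x³ from the other leaf x^b: a path
-- to a vertex outside the gadget leaves it through x¹ or x², both adjacent to x³ and to x^b, so
-- disjoint paths from one can be rerouted to start at the other; and both x³ and x^b have
-- three disjoint paths to x^a, which has degree 3.
module Submission where

open import Defs
open import Data.Nat as ℕ using (ℕ; _≤_; _+_; _*_)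
open import Data.List using (List; length; []; _∷_; _++_; [_]; map; lookup)
open import Data.List.Relation.Unary.Unique.Propositional using (Unique)
open import Data.Empty using (⊥; ⊥-elim)
open import Data.Fin as Fin using (Fin; zero; suc; inject≤)
open import Data.Fin.Properties using (inject≤-injective; injective⇒≤; *↔×; +↔⊎)
open import Data.List.Properties using (map-++; map-injective; ∷-injectiveˡ)
open import Data.List.Membership.Propositional using (_∈_; _∉_; find; lose)
open import Data.List.Membership.Propositional.Properties using (∈-lookup; ∈-map⁻; ∈-++⁺ˡ)
import Data.List.Membership.DecPropositional as DecMembership
open import Data.List.Relation.Binary.Subset.Propositional using (_⊆_)
open import Data.List.Relation.Binary.Subset.Propositional.Properties using (xs⊆ys++xs)
open import Data.List.Relation.Unary.All as All using (All; []; _∷_)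
open import Data.List.Relation.Unary.All.Properties using (++⁺)
open import Data.List.Relation.Unary.AllPairs using ([]; _∷_)
open import Data.List.Relation.Unary.Any as Any using (here; there; any?)
open import Data.List.Relation.Unary.Any.Properties using (lookup-index)
open import Data.List.Relation.Unary.Unique.Propositional.Properties using () renaming (map⁺ to Unique-map⁺)
open import Data.Nat.Properties using (≤-antisym; ≮⇒≥)
open import Data.Product using (∃; _×_; _,_; proj₁; proj₂)
open import Data.Product.Function.NonDependent.Propositional using (_×-↣_)
import Data.Product.Properties as Productₚ
open import Data.Sum as Sum using (_⊎_; inj₁; inj₂)
open import Data.Sum.Algebra using (⊎-comm)
import Data.Sum.Properties as Sumₚ
open import Data.Unit using (tt)
open import Function using (_∘_; Injective; _⇔_; mk⇔; _↔_; _↣_; Injection; Equivalence)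
open import Function.Construct.Composition using (_↣-∘_; _↔-∘_)
open import Function.Construct.Identity using (↣-id)
open import Function.Properties.Inverse using (↔⇒↣)
open import Relation.Binary.Definitions using (DecidableEquality)
open import Relation.Binary.PropositionalEquality using (_≡_; _≢_; refl; sym; trans; cong; subst; subst₂)
open import Relation.Nullary using (¬_; Dec; yes; no)
open import Relation.Unary using (Decidable)

module _ {A : Set} where

  Unique-lookup : ∀ {xs : List A} → Unique xs → ∀ {i j} → i ≢ j → lookup xs i ≢ lookup xs j
  Unique-lookup {_ ∷ _} _          {zero}  {zero}  i≢j = λ _ → i≢j refl
  Unique-lookup {_ ∷ _} (x≢ ∷ _)   {zero}  {suc j} _   = All.lookup x≢ (∈-lookup j)
  Unique-lookup {_ ∷ _} (x≢ ∷ _)   {suc i} {zero}  _   = All.lookup x≢ (∈-lookup i) ∘ sym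
  Unique-lookup {_ ∷ _} (_ ∷ xs!)  {suc i} {suc j} i≢j = Unique-lookup xs! (i≢j ∘ cong suc)

  ∈-injection⇒≤ : ∀ {k} {xs : List A} (f : Fin k → A) → Injective _≡_ _≡_ f →
                  (∀ i → f i ∈ xs) → k ≤ length xs
  ∈-injection⇒≤ {xs = xs} f f-injective f∈xs = injective⇒≤ index-injective
    where
    index-injective : Injective _≡_ _≡_ (Any.index ∘ f∈xs)
    index-injective {i} {j} eq = f-injective (trans (lookup-index (f∈xs i))
      (trans (cong (lookup xs) eq) (sym (lookup-index (f∈xs j)))))

module _ {A : Set} {P : A → Set} (P? : Decidable P) where

  data LastHit : List A → Set where
    none : ∀ {xs} → All (¬_ ∘ P) xs → LastHit xs
    hit  : ∀ pre {x} post → P x → All (¬_ ∘ P) post → LastHit (pre ++ x ∷ post)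

  lastHit : ∀ xs → LastHit xs
  lastHit [] = none []
  lastHit (x ∷ xs) with lastHit xs
  ... | hit pre post px out = hit (x ∷ pre) post px out
  ... | none out with P? x
  ...   | yes px = hit [] xs px out
  ...   | no ¬px = none (¬px ∷ out)

module _ {A B : Set} (class : A → B) (W : List A) where

  record TwoIn (b : B) : Set where
    constructor two
    field
      fst snd   : A
      fst≢snd   : fst ≢ snd
      fst∈W     : fst ∈ W
      snd∈W     : snd ∈ W
      class-fst : class fst ≡ b
      class-snd : class snd ≡ b

  two-per-class⇒≤ : ∀ {N} → Fin N ↔ B → (∀ b → TwoIn b) → 2 * N ≤ length W
  two-per-class⇒≤ {N} classes twoIn =
    ∈-injection⇒≤ (pick ∘ Injection.to slot) (Injection.injective slot ∘ pick-injective)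
                  (pick∈W ∘ Injection.to slot)
    where
    open TwoIn

    slot : Fin (2 * N) ↣ (Fin 2 × B)
    slot = (↣-id _ ×-↣ ↔⇒↣ classes) ↣-∘ ↔⇒↣ (*↔× {2} {N})

    pick : Fin 2 × B → A
    pick (zero , b)     = fst (twoIn b)
    pick (suc zero , b) = snd (twoIn b)

    pick∈W : ∀ p → pick p ∈ W
    pick∈W (zero , b)     = fst∈W (twoIn b)
    pick∈W (suc zero , b) = snd∈W (twoIn b)

    class-pick : ∀ p → class (pick p) ≡ proj₂ p
    class-pick (zero , b)     = class-fst (twoIn b)
    class-pick (suc zero , b) = class-snd (twoIn b)

    pick-injectiveˡ : ∀ {b} x y → pick (x , b) ≡ pick (y , b) → x ≡ y
    pick-injectiveˡ zero       zero       _  = refl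
    pick-injectiveˡ zero       (suc zero) eq = ⊥-elim (fst≢snd (twoIn _) eq)
    pick-injectiveˡ (suc zero) zero       eq = ⊥-elim (fst≢snd (twoIn _) (sym eq))
    pick-injectiveˡ (suc zero) (suc zero) _  = refl

    pick-injective : Injective _≡_ _≡_ pick
    pick-injective {x , b} {y , c} eq
      with trans (sym (class-pick (x , b))) (trans (cong class eq) (class-pick (y , c)))
    ... | refl = cong (_, b) (pick-injectiveˡ x y eq)

module DisjointPaths {V : Set} (Adj : V → V → Set) where
  open GraphNotions Adj

  HasDisjointPaths-≤ : ∀ {v w j k} → j ≤ k → HasDisjointPaths v w k → HasDisjointPaths v w j
  HasDisjointPaths-≤ {j = j} {k} j≤k (mids , paths , disjoint) =
    mids ∘ shrink , paths ∘ shrink ,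
    λ i i′ i≢i′ → disjoint (shrink i) (shrink i′) (i≢i′ ∘ inject≤-injective j≤k j≤k i i′)
    where
    shrink : Fin j → Fin k
    shrink i = inject≤ i j≤k

  ¬HasDisjointPaths-suc⇒≤ : ∀ {v w c d} → ¬ HasDisjointPaths v w (ℕ.suc d) →
                            HasDisjointPaths v w c → c ≤ d
  ¬HasDisjointPaths-suc⇒≤ ¬paths paths = ≮⇒≥ (λ d<c → ¬paths (HasDisjointPaths-≤ d<c paths))

  Kappa-≡ : ∀ {u v w a b} → u ≢ w → v ≢ w →
            (∀ c → HasDisjointPaths u w c ⇔ HasDisjointPaths v w c) →
            Kappa u w a → Kappa v w b → a ≡ b
  Kappa-≡ u≢w _   _ (inj₁ (u≡w , _)) _                = ⊥-elim (u≢w u≡w)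
  Kappa-≡ _   v≢w _ (inj₂ _)         (inj₁ (v≡w , _)) = ⊥-elim (v≢w v≡w)
  Kappa-≡ _ _ same (inj₂ (_ , c , refl , u-c , ¬u-c+1)) (inj₂ (_ , d , refl , v-d , ¬v-d+1)) =
    cong fin (≤-antisym (¬HasDisjointPaths-suc⇒≤ ¬v-d+1 (Equivalence.to (same c) u-c))
                        (¬HasDisjointPaths-suc⇒≤ ¬u-c+1 (Equivalence.from (same d) v-d)))

  Resolving⇒separates : ∀ {W u v} → Resolving W → u ∉ W → v ∉ W →
                        (∀ {w} → w ∈ W → ∀ c → HasDisjointPaths u w c ⇔ HasDisjointPaths v w c) →
                        u ≡ v
  Resolving⇒separates {W} res u∉W v∉W same =
    res _ _ λ w w∈W _ _ → Kappa-≡ (outside u∉W w∈W) (outside v∉W w∈W) (same w∈W)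
    where
    outside : ∀ {x w} → x ∉ W → w ∈ W → x ≢ w
    outside x∉W w∈W refl = x∉W w∈W

  module _ {σ : V → V} (σ-injective : Injective _≡_ _≡_ σ)
           (σ-adj : ∀ {x y} → Adj x y → Adj (σ x) (σ y)) where

    AdjChain-map : ∀ xs → AdjChain xs → AdjChain (map σ xs)
    AdjChain-map []           _          = tt
    AdjChain-map (_ ∷ [])     _          = tt
    AdjChain-map (_ ∷ y ∷ xs) (xy , chain) = σ-adj xy , AdjChain-map (y ∷ xs) chain

    IsPathVia-map : ∀ {u w mid} → IsPathVia u w mid → IsPathVia (σ u) (σ w) (map σ mid)
    IsPathVia-map {u} {w} {mid} (path! , chain) =
      subst (λ xs → Unique xs × AdjChain xs) (cong (σ u ∷_) (map-++ σ mid [ w ]))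
            (Unique-map⁺ σ-injective path! , AdjChain-map _ chain)

    HasDisjointPaths-map : ∀ {u w c} → HasDisjointPaths u w c → HasDisjointPaths (σ u) (σ w) c
    HasDisjointPaths-map (mids , paths , disjoint) =
      map σ ∘ mids , IsPathVia-map ∘ paths ,
      λ i j i≢j → proj₁ (disjoint i j i≢j) ∘ map-injective σ-injective ,
                  λ x x∈i x∈j → let y , y∈i , x≡σy = ∈-map⁻ σ x∈i
                                    z , z∈j , x≡σz = ∈-map⁻ σ x∈j
                                in proj₂ (disjoint i j i≢j) y y∈i
                                     (subst (_∈ mids j) (σ-injective (trans (sym x≡σz) x≡σy)) z∈j)

  penultimate : V → List V → V
  penultimate v []        = v
  penultimate _ (x ∷ mid) = penultimate x mid

  penultimate-adj : ∀ {w} v mid → AdjChain (v ∷ mid ++ [ w ]) → Adj (penultimate v mid) w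
  penultimate-adj v []        (vw , _)    = vw
  penultimate-adj v (x ∷ mid) (_ , chain) = penultimate-adj x mid chain

  penultimate-∈ : ∀ x mid → penultimate x mid ∈ x ∷ mid
  penultimate-∈ x []        = here refl
  penultimate-∈ x (y ∷ mid) = there (penultimate-∈ y mid)

  start∉mid : ∀ {v w mid} → IsPathVia v w mid → v ∉ mid
  start∉mid ((v≢ ∷ _) , _) v∈mid = All.lookup v≢ (∈-++⁺ˡ v∈mid) refl

  penultimate-distinct : ∀ {v w mid mid′} → IsPathVia v w mid → IsPathVia v w mid′ → mid ≢ mid′ →
                   (∀ x → x ∈ mid → x ∉ mid′) → penultimate v mid ≢ penultimate v mid′
  penultimate-distinct {mid = []}    {[]}       _ _  mid≢mid′ _ _ = mid≢mid′ refl
  penultimate-distinct {mid = []}    {x ∷ mid′} _ p′ _ _ eq =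
    start∉mid p′ (subst (_∈ x ∷ mid′) (sym eq) (penultimate-∈ x mid′))
  penultimate-distinct {mid = x ∷ mid} {[]}     p _  _ _ eq =
    start∉mid p (subst (_∈ x ∷ mid) eq (penultimate-∈ x mid))
  penultimate-distinct {mid = x ∷ mid} {y ∷ mid′} _ _ _ disjoint eq =
    disjoint _ (penultimate-∈ x mid) (subst (_∈ y ∷ mid′) (sym eq) (penultimate-∈ y mid′))

  HasDisjointPaths-≤-degree : ∀ {v w k} (ns : List V) → (∀ {y} → Adj y w → y ∈ ns) →
                              HasDisjointPaths v w k → k ≤ length ns
  HasDisjointPaths-≤-degree {v} ns nbr∈ns (mids , paths , disjoint) =
    ∈-injection⇒≤ last last-injective (λ i → nbr∈ns (penultimate-adj v (mids i) (proj₂ (paths i))))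
    where
    last : Fin _ → V
    last i = penultimate v (mids i)
    last-injective : Injective _≡_ _≡_ last
    last-injective {i} {j} eq with i Fin.≟ j
    ... | yes i≡j = i≡j
    ... | no i≢j  = ⊥-elim (penultimate-distinct (paths i) (paths j)
                              (proj₁ (disjoint i j i≢j)) (proj₂ (disjoint i j i≢j)) eq)

  HasDisjointPaths-⇔-at-max : ∀ {u v w k} → (∀ {x c} → HasDisjointPaths x w c → c ≤ k) →
                              HasDisjointPaths u w k → HasDisjointPaths v w k →
                              ∀ c → HasDisjointPaths u w c ⇔ HasDisjointPaths v w c
  HasDisjointPaths-⇔-at-max bound u-k v-k c =
    mk⇔ (λ u-c → HasDisjointPaths-≤ (bound u-c) v-k) (λ v-c → HasDisjointPaths-≤ (bound v-c) u-k)

  IsPathVia-suffix : ∀ {u w} pre {x post} → IsPathVia u w (pre ++ x ∷ post) → IsPathVia x w post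
  IsPathVia-suffix []        ((_ ∷ x!) , (_ , chain)) = x! , chain
  IsPathVia-suffix (y ∷ pre) ((_ ∷ y!) , (_ , chain)) = IsPathVia-suffix pre (y! , chain)

  IsPathVia-∷ : ∀ {v x w post} → All (v ≢_) (x ∷ post ++ [ w ]) → Adj v x →
                IsPathVia x w post → IsPathVia v w (x ∷ post)
  IsPathVia-∷ v∉ vx (x! , chain) = (v∉ ∷ x!) , vx , chain

  record Reroute (v w : V) (mid : List V) : Set where
    constructor reroute
    field
      first : V
      rest  : List V
      path  : IsPathVia v w (first ∷ rest)
      ⊆mid  : first ∷ rest ⊆ mid

  HasDisjointPaths-reroute : ∀ {u v w c} → (∀ {mid} → IsPathVia u w mid → Reroute v w mid) →
                             HasDisjointPaths u w c → HasDisjointPaths v w c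
  HasDisjointPaths-reroute {v = v} {w} {c} rerouted (mids , paths , disjoint) =
    mids′ , path ∘ r , disjoint′
    where
    open Reroute
    r : ∀ i → Reroute v w (mids i)
    r i = rerouted (paths i)
    mids′ : Fin c → List V
    mids′ i = first (r i) ∷ rest (r i)
    disjoint′ : ∀ i j → i ≢ j → (mids′ i ≢ mids′ j) × (∀ x → x ∈ mids′ i → x ∉ mids′ j)
    disjoint′ i j i≢j =
      (λ eq → apart _ (⊆mid (r i) (here refl)) (⊆mid (r j) (subst (first (r i) ∈_) eq (here refl)))) ,
      λ x x∈i x∈j → apart x (⊆mid (r i) x∈i) (⊆mid (r j) x∈j)
      where
      apart : ∀ x → x ∈ mids i → x ∉ mids j
      apart = proj₂ (disjoint i j i≢j)

  -- Every edge leaving P starts at a gate. A u–w path is cut at its last vertex in P, a gate g,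
  -- and restarted as v, g, …; the new paths use subsets of the old interiors, so stay disjoint.
  module Gates (P : V → Set) (P? : Decidable P) (Gate : V → Set)
               (exit : ∀ {x y} → Adj x y → P x → ¬ P y → Gate x) {w : V} (w∉P : ¬ P w) where

    exits-at : ∀ {x post} → P x → All (¬_ ∘ P) post → AdjChain (x ∷ post ++ [ w ]) → Gate x
    exits-at {post = []}    x∈P _           (xw , _) = exit xw x∈P w∉P
    exits-at {post = _ ∷ _} x∈P (y∉P ∷ _) (xy , _) = exit xy x∈P y∉P

    reroute-via-gate : ∀ {u v mid} → P u → ¬ Gate u → P v → ¬ Gate v →
                       (∀ {g} → Gate g → Adj v g) → IsPathVia u w mid → Reroute v w mid
    reroute-via-gate {v = v} {mid} u∈P u∉Gate v∈P v∉Gate v-gates path with lastHit P? mid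
    ... | none out = ⊥-elim (u∉Gate (exits-at u∈P out (proj₂ path)))
    ... | hit pre {g} post g∈P out =
      reroute g post (IsPathVia-∷ v∉ (v-gates gate) suffix) (xs⊆ys++xs (g ∷ post) pre)
      where
      suffix : IsPathVia g w post
      suffix = IsPathVia-suffix pre path
      gate : Gate g
      gate = exits-at g∈P out (proj₂ suffix)
      v∉ : All (v ≢_) (g ∷ post ++ [ w ])
      v∉ = (λ { refl → v∉Gate gate }) ∷
           ++⁺ (All.map (λ y∉P → λ { refl → y∉P v∈P }) out) ((λ { refl → w∉P v∈P }) ∷ [])

    HasDisjointPaths-via-gates : ∀ {u v c} → P u → ¬ Gate u → P v → ¬ Gate v →
                                 (∀ {g} → Gate g → Adj v g) →
                                 HasDisjointPaths u w c → HasDisjointPaths v w c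
    HasDisjointPaths-via-gates u∈P u∉Gate v∈P v∉Gate v-gates =
      HasDisjointPaths-reroute (reroute-via-gate u∈P u∉Gate v∈P v∉Gate v-gates)

  record Twins (u v : V) : Set where
    field
      distinct : u ≢ v
      nbr-u⇒v  : ∀ {y} → y ≢ v → Adj u y → Adj v y
      nbr-v⇒u  : ∀ {y} → y ≢ u → Adj v y → Adj u y

  module SimpleGraph (_≟_ : DecidableEquality V) (Adj-sym : ∀ {x y} → Adj x y → Adj y x)
                     (Adj-irrefl : ∀ {x} → ¬ Adj x x) where

    Adj⇒≢ : ∀ {x y} → Adj x y → x ≢ y
    Adj⇒≢ xy refl = Adj-irrefl xy

    module Transposition {u v : V} (twins : Twins u v) where
      open Twins twins

      select : ∀ {x} → Dec (x ≡ u) → Dec (x ≡ v) → V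
      select     (yes _) _       = v
      select     (no _)  (yes _) = u
      select {x} (no _)  (no _)  = x

      transpose : V → V
      transpose x = select (x ≟ u) (x ≟ v)

      data TransposeView (x : V) : V → Set where
        at-u  : x ≡ u → TransposeView x v
        at-v  : x ≡ v → TransposeView x u
        fixed : x ≢ u → x ≢ v → TransposeView x x

      transposeView : ∀ x → TransposeView x (transpose x)
      transposeView x = view (x ≟ u) (x ≟ v)
        where
        view : (p : Dec (x ≡ u)) (q : Dec (x ≡ v)) → TransposeView x (select p q)
        view (yes x≡u) _         = at-u x≡u
        view (no _)    (yes x≡v) = at-v x≡v
        view (no x≢u)  (no x≢v)  = fixed x≢u x≢v

      transpose-u : transpose u ≡ v
      transpose-u with transpose u | transposeView u
      ... | _ | at-u _       = refl
      ... | _ | at-v u≡v     = ⊥-elim (distinct u≡v)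
      ... | _ | fixed u≢u _  = ⊥-elim (u≢u refl)

      transpose-v : transpose v ≡ u
      transpose-v with transpose v | transposeView v
      ... | _ | at-u v≡u     = ⊥-elim (distinct (sym v≡u))
      ... | _ | at-v _       = refl
      ... | _ | fixed _ v≢v  = ⊥-elim (v≢v refl)

      transpose-fixed : ∀ {x} → x ≢ u → x ≢ v → transpose x ≡ x
      transpose-fixed {x} x≢u x≢v with transpose x | transposeView x
      ... | _ | at-u x≡u  = ⊥-elim (x≢u x≡u)
      ... | _ | at-v x≡v  = ⊥-elim (x≢v x≡v)
      ... | _ | fixed _ _ = refl

      transpose-involutive : ∀ x → transpose (transpose x) ≡ x
      transpose-involutive x with transpose x | transposeView x
      ... | _ | at-u refl         = transpose-v
      ... | _ | at-v refl         = transpose-u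
      ... | _ | fixed x≢u x≢v     = transpose-fixed x≢u x≢v

      transpose-injective : Injective _≡_ _≡_ transpose
      transpose-injective {x} {y} eq =
        trans (sym (transpose-involutive x)) (trans (cong transpose eq) (transpose-involutive y))

      transpose-adj : ∀ {x y} → Adj x y → Adj (transpose x) (transpose y)
      transpose-adj {x} {y} xy with transpose x | transposeView x | transpose y | transposeView y
      ... | _ | at-u refl     | _ | at-u refl     = ⊥-elim (Adj-irrefl xy)
      ... | _ | at-u refl     | _ | at-v refl     = Adj-sym xy
      ... | _ | at-u refl     | _ | fixed _ y≢v   = nbr-u⇒v y≢v xy
      ... | _ | at-v refl     | _ | at-u refl     = Adj-sym xy
      ... | _ | at-v refl     | _ | at-v refl     = ⊥-elim (Adj-irrefl xy)
      ... | _ | at-v refl     | _ | fixed y≢u _   = nbr-v⇒u y≢u xy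
      ... | _ | fixed _ x≢v   | _ | at-u refl     = Adj-sym (nbr-u⇒v x≢v (Adj-sym xy))
      ... | _ | fixed x≢u _   | _ | at-v refl     = Adj-sym (nbr-v⇒u x≢u (Adj-sym xy))
      ... | _ | fixed _ _     | _ | fixed _ _     = xy

      twins-⇔ : ∀ {w} → w ≢ u → w ≢ v → ∀ c → HasDisjointPaths u w c ⇔ HasDisjointPaths v w c
      twins-⇔ {w} w≢u w≢v c = mk⇔ (move transpose-u) (move transpose-v)
        where
        move : ∀ {x y} → transpose x ≡ y → HasDisjointPaths x w c → HasDisjointPaths y w c
        move σx≡y = subst₂ (λ a b → HasDisjointPaths a b c) σx≡y (transpose-fixed w≢u w≢v)
                  ∘ HasDisjointPaths-map transpose-injective transpose-adj

    twins∉⇒¬Resolving : ∀ {W u v} → Twins u v → u ∉ W → v ∉ W → ¬ Resolving W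
    twins∉⇒¬Resolving {W} twins u∉W v∉W res =
      Twins.distinct twins (Resolving⇒separates res u∉W v∉W λ w∈W →
        Transposition.twins-⇔ twins (outside u∉W w∈W) (outside v∉W w∈W))
      where
      outside : ∀ {x w} → x ∉ W → w ∈ W → w ≢ x
      outside x∉W w∈W refl = x∉W w∈W

    HasDisjointPaths-common : ∀ {s t} → s ≢ t → (ns : List V) → Unique ns →
                              (∀ {y} → y ∈ ns → Adj s y × Adj y t) → HasDisjointPaths s t (length ns)
    HasDisjointPaths-common {s} {t} s≢t ns ns! common =
      (λ i → [ lookup ns i ]) , (λ i → via (common (∈-lookup i))) ,
      λ i j i≢j → Unique-lookup ns! i≢j ∘ ∷-injectiveˡ ,
                  λ { _ (here refl) (here eq) → Unique-lookup ns! i≢j eq }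
      where
      via : ∀ {y} → Adj s y × Adj y t → IsPathVia s t [ y ]
      via (sy , yt) = ((Adj⇒≢ sy ∷ s≢t ∷ []) ∷ (Adj⇒≢ yt ∷ []) ∷ [] ∷ []) , sy , yt , tt

    HasDisjointPaths-common+edge : ∀ {s t} → Adj s t → (ns : List V) → Unique ns →
                                   (∀ {y} → y ∈ ns → Adj s y × Adj y t) →
                                   HasDisjointPaths s t (ℕ.suc (length ns))
    HasDisjointPaths-common+edge {s} {t} st ns ns! common = mids , paths , disjoint
      where
      two-step : HasDisjointPaths s t (length ns)
      two-step = HasDisjointPaths-common (Adj⇒≢ st) ns ns! common
      mids : Fin (ℕ.suc (length ns)) → List V
      mids zero    = []
      mids (suc i) = proj₁ two-step i
      paths : ∀ i → IsPathVia s t (mids i)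
      paths zero    = ((Adj⇒≢ st ∷ []) ∷ [] ∷ []) , st , tt
      paths (suc i) = proj₁ (proj₂ two-step) i
      disjoint : ∀ i j → i ≢ j → (mids i ≢ mids j) × (∀ x → x ∈ mids i → x ∉ mids j)
      disjoint zero    zero    i≢j = ⊥-elim (i≢j refl)
      disjoint zero    (suc _) _   = (λ ()) , λ _ ()
      disjoint (suc _) zero    _   = (λ ()) , λ _ _ ()
      disjoint (suc i) (suc j) i≢j = proj₂ (proj₂ two-step) i j (i≢j ∘ cong suc)

data LeafPair : Fin 5 → Fin 5 → Set where
  x⁴x⁵ : LeafPair f3 f4
  x⁵x⁴ : LeafPair f4 f3

LeafPair-irrefl : ∀ {a} → ¬ LeafPair a a
LeafPair-irrefl ()

LeafPair-sym : ∀ {a b} → LeafPair a b → LeafPair b a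
LeafPair-sym x⁴x⁵ = x⁵x⁴
LeafPair-sym x⁵x⁴ = x⁴x⁵

data Inner : Fin 5 → Set where
  x³ : Inner f2
  x⁴ : Inner f3
  x⁵ : Inner f4

other-leaf-inner : ∀ {a b} → LeafPair a b → Inner b
other-leaf-inner x⁴x⁵ = x⁵
other-leaf-inner x⁵x⁴ = x⁴

data Mid : Fin 6 → Set where
  c³ : Mid f2
  c⁴ : Mid f3
  c⁵ : Mid f4

module _ {n m : ℕ} where

  X : Fin n → Fin 5 → GV n m
  X i a = inj₁ (i , a)

  C : Fin m → Fin 6 → GV n m
  C j a = inj₂ (j , a)

  gadget : GV n m → Fin n ⊎ Fin m
  gadget = Sum.map proj₁ proj₁

  _≟_ : DecidableEquality (GV n m)
  _≟_ = Sumₚ.≡-dec (Productₚ.≡-dec Fin._≟_ Fin._≟_) (Productₚ.≡-dec Fin._≟_ Fin._≟_)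

  core : Fin n → List (GV n m)
  core i = X i f0 ∷ X i f1 ∷ X i f2 ∷ []

  core-unique : ∀ i → Unique (core i)
  core-unique i = ((λ ()) ∷ (λ ()) ∷ []) ∷ ((λ ()) ∷ []) ∷ [] ∷ []

  core-gadget : ∀ {i y} → y ∈ core i → gadget y ≡ inj₁ i
  core-gadget (here refl)                 = refl
  core-gadget (there (here refl))         = refl
  core-gadget (there (there (here refl))) = refl

  data Gate (i : Fin n) : GV n m → Set where
    x¹ : Gate i (X i f0)
    x² : Gate i (X i f1)

  InVarGadget : Fin n → GV n m → Set
  InVarGadget i y = gadget y ≡ inj₁ i

  InVarGadget? : ∀ i → Decidable (InVarGadget i)
  InVarGadget? i y = Sumₚ.≡-dec Fin._≟_ Fin._≟_ (gadget y) (inj₁ i)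

  var-vertex-cases : ∀ {i a b} → LeafPair a b → ∀ c → X i c ∈ core i ⊎ c ≡ a ⊎ c ≡ b
  var-vertex-cases _    zero                            = inj₁ (here refl)
  var-vertex-cases _    (suc zero)                      = inj₁ (there (here refl))
  var-vertex-cases _    (suc (suc zero))                = inj₁ (there (there (here refl)))
  var-vertex-cases x⁴x⁵ (suc (suc (suc zero)))          = inj₂ (inj₁ refl)
  var-vertex-cases x⁴x⁵ (suc (suc (suc (suc zero))))    = inj₂ (inj₂ refl)
  var-vertex-cases x⁵x⁴ (suc (suc (suc zero)))          = inj₂ (inj₂ refl)
  var-vertex-cases x⁵x⁴ (suc (suc (suc (suc zero))))    = inj₂ (inj₁ refl)

  module _ (S : ThreeSAT n m) where
    open GraphNotions (Adj S)
    open DisjointPaths (Adj S)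

    Adj-sym : ∀ {x y} → Adj S x y → Adj S y x
    Adj-sym = Sum.swap

    Edge-irrefl : ∀ {x} → ¬ Edge S x x
    Edge-irrefl (var _ ())
    Edge-irrefl (clause _ ())
    Edge-irrefl (cc _ _ j≢j _ _) = j≢j refl

    Adj-irrefl : ∀ {x} → ¬ Adj S x x
    Adj-irrefl = Sum.[ Edge-irrefl , Edge-irrefl ]

    open SimpleGraph _≟_ Adj-sym Adj-irrefl

    core-adj-leaf : ∀ {i a b y} → LeafPair a b → y ∈ core i → Adj S y (X i a)
    core-adj-leaf x⁴x⁵ (here refl)                 = inj₁ (var _ e14)
    core-adj-leaf x⁴x⁵ (there (here refl))         = inj₁ (var _ e24)
    core-adj-leaf x⁴x⁵ (there (there (here refl))) = inj₁ (var _ e34)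
    core-adj-leaf x⁵x⁴ (here refl)                 = inj₁ (var _ e15)
    core-adj-leaf x⁵x⁴ (there (here refl))         = inj₁ (var _ e25)
    core-adj-leaf x⁵x⁴ (there (there (here refl))) = inj₁ (var _ e35)

    leaf-nbr∈core : ∀ {i a b y} → LeafPair a b → Adj S y (X i a) → y ∈ core i
    leaf-nbr∈core x⁴x⁵ (inj₁ (var _ e14))         = here refl
    leaf-nbr∈core x⁴x⁵ (inj₁ (var _ e24))         = there (here refl)
    leaf-nbr∈core x⁴x⁵ (inj₁ (var _ e34))         = there (there (here refl))
    leaf-nbr∈core x⁴x⁵ (inj₁ (lit _ _ _ _ ()))
    leaf-nbr∈core x⁴x⁵ (inj₂ (var _ ()))
    leaf-nbr∈core x⁵x⁴ (inj₁ (var _ e15))         = here refl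
    leaf-nbr∈core x⁵x⁴ (inj₁ (var _ e25))         = there (here refl)
    leaf-nbr∈core x⁵x⁴ (inj₁ (var _ e35))         = there (there (here refl))
    leaf-nbr∈core x⁵x⁴ (inj₁ (lit _ _ _ _ ()))
    leaf-nbr∈core x⁵x⁴ (inj₂ (var _ ()))

    leaf-twins : ∀ {i a b} → LeafPair a b → Twins (X i a) (X i b)
    leaf-twins lp = record
      { distinct = λ { refl → LeafPair-irrefl lp }
      ; nbr-u⇒v  = λ _ → Adj-sym ∘ core-adj-leaf (LeafPair-sym lp) ∘ leaf-nbr∈core lp ∘ Adj-sym
      ; nbr-v⇒u  = λ _ → Adj-sym ∘ core-adj-leaf lp ∘ leaf-nbr∈core (LeafPair-sym lp) ∘ Adj-sym
      }

    var-exit : ∀ {i x y} → Adj S x y → InVarGadget i x → ¬ InVarGadget i y → Gate i x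
    var-exit (inj₁ (var _ _))          x∈ y∉ = ⊥-elim (y∉ x∈)
    var-exit (inj₂ (var _ _))          x∈ y∉ = ⊥-elim (y∉ x∈)
    var-exit (inj₂ (lit _ _ _ _ p11)) refl _ = x¹
    var-exit (inj₂ (lit _ _ _ _ p21)) refl _ = x¹
    var-exit (inj₂ (lit _ _ _ _ p22)) refl _ = x²
    var-exit (inj₂ (lit _ _ _ _ n11)) refl _ = x¹
    var-exit (inj₂ (lit _ _ _ _ n12)) refl _ = x²
    var-exit (inj₂ (lit _ _ _ _ n22)) refl _ = x²

    inner∉Gate : ∀ {i a} → Inner a → ¬ Gate i (X i a)
    inner∉Gate x³ ()
    inner∉Gate x⁴ ()
    inner∉Gate x⁵ ()

    inner-adj-gate : ∀ {i a g} → Inner a → Gate i g → Adj S (X i a) g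
    inner-adj-gate x³ x¹ = inj₂ (var _ e13)
    inner-adj-gate x³ x² = inj₂ (var _ e23)
    inner-adj-gate x⁴ x¹ = inj₂ (var _ e14)
    inner-adj-gate x⁴ x² = inj₂ (var _ e24)
    inner-adj-gate x⁵ x¹ = inj₂ (var _ e15)
    inner-adj-gate x⁵ x² = inj₂ (var _ e25)

    inner-⇔-outside : ∀ {i a b w} → Inner a → Inner b → ¬ InVarGadget i w →
                      ∀ c → HasDisjointPaths (X i a) w c ⇔ HasDisjointPaths (X i b) w c
    inner-⇔-outside {i} {w = w} ia ib w∉ c = mk⇔ (via-gates ia ib) (via-gates ib ia)
      where
      open Gates (InVarGadget i) (InVarGadget? i) (Gate i) var-exit {w} w∉
      via-gates : ∀ {a b} → Inner a → Inner b → HasDisjointPaths (X i a) w c → HasDisjointPaths (X i b) w c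
      via-gates ia ib =
        HasDisjointPaths-via-gates refl (inner∉Gate ia) refl (inner∉Gate ib) (inner-adj-gate ib)

    leaf-⇔ : ∀ {i a b} → LeafPair a b →
             ∀ c → HasDisjointPaths (X i f2) (X i a) c ⇔ HasDisjointPaths (X i b) (X i a) c
    leaf-⇔ {i} lp = HasDisjointPaths-⇔-at-max (HasDisjointPaths-≤-degree (core i) (leaf-nbr∈core lp))
      (HasDisjointPaths-common+edge (core-adj-leaf lp (there (there (here refl))))
         (X i f0 ∷ X i f1 ∷ []) (((λ ()) ∷ []) ∷ [] ∷ [])
         λ { (here refl) → inj₂ (var _ e13) , core-adj-leaf lp (here refl)
           ; (there (here refl)) → inj₂ (var _ e23) , core-adj-leaf lp (there (here refl)) })
      (HasDisjointPaths-common (λ { refl → LeafPair-irrefl lp }) (core i) (core-unique i)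
         λ y∈core → Adj-sym (core-adj-leaf (LeafPair-sym lp) y∈core) , core-adj-leaf lp y∈core)

    mid-nbr∈clause : ∀ {j a y} → Mid a → Adj S (C j a) y → ∃ λ b → y ≡ C j b
    mid-nbr∈clause _  (inj₁ (clause _ _))        = _ , refl
    mid-nbr∈clause _  (inj₂ (clause _ _))        = _ , refl
    mid-nbr∈clause c³ (inj₁ (lit _ _ _ _ ()))
    mid-nbr∈clause c⁴ (inj₁ (lit _ _ _ _ ()))
    mid-nbr∈clause c⁵ (inj₁ (lit _ _ _ _ ()))
    mid-nbr∈clause c³ (inj₁ (cc _ _ _ () _))
    mid-nbr∈clause c⁴ (inj₁ (cc _ _ _ () _))
    mid-nbr∈clause c⁵ (inj₁ (cc _ _ _ () _))
    mid-nbr∈clause c³ (inj₂ (cc _ _ _ _ ()))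
    mid-nbr∈clause c⁴ (inj₂ (cc _ _ _ _ ()))
    mid-nbr∈clause c⁵ (inj₂ (cc _ _ _ _ ()))

    adj-mid : ∀ {j a b} → Mid b → a ≢ b → Adj S (C j a) (C j b)
    adj-mid {a = zero}                        c³ _ = inj₁ (clause _ c13)
    adj-mid {a = zero}                        c⁴ _ = inj₁ (clause _ c14)
    adj-mid {a = zero}                        c⁵ _ = inj₁ (clause _ c15)
    adj-mid {a = suc zero}                    c³ _ = inj₁ (clause _ c23)
    adj-mid {a = suc zero}                    c⁴ _ = inj₁ (clause _ c24)
    adj-mid {a = suc zero}                    c⁵ _ = inj₁ (clause _ c25)
    adj-mid {a = suc (suc zero)}              c³ a≢b = ⊥-elim (a≢b refl)
    adj-mid {a = suc (suc zero)}              c⁴ _ = inj₁ (clause _ c34)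
    adj-mid {a = suc (suc zero)}              c⁵ _ = inj₁ (clause _ c35)
    adj-mid {a = suc (suc (suc zero))}        c³ _ = inj₂ (clause _ c34)
    adj-mid {a = suc (suc (suc zero))}        c⁴ a≢b = ⊥-elim (a≢b refl)
    adj-mid {a = suc (suc (suc zero))}        c⁵ _ = inj₁ (clause _ c45)
    adj-mid {a = suc (suc (suc (suc zero)))}  c³ _ = inj₂ (clause _ c35)
    adj-mid {a = suc (suc (suc (suc zero)))}  c⁴ _ = inj₂ (clause _ c45)
    adj-mid {a = suc (suc (suc (suc zero)))}  c⁵ a≢b = ⊥-elim (a≢b refl)
    adj-mid {a = suc (suc (suc (suc (suc zero))))}c³ _ = inj₁ (clause _ c63)
    adj-mid {a = suc (suc (suc (suc (suc zero))))}c⁴ _ = inj₁ (clause _ c64)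
    adj-mid {a = suc (suc (suc (suc (suc zero))))}c⁵ _ = inj₁ (clause _ c65)

    mid-twins : ∀ {j a b} → Mid a → Mid b → a ≢ b → Twins (C j a) (C j b)
    mid-twins ma mb a≢b = record
      { distinct = λ { refl → a≢b refl }
      ; nbr-u⇒v  = nbr ma mb
      ; nbr-v⇒u  = nbr mb ma
      }
      where
      nbr : ∀ {j a b y} → Mid a → Mid b → y ≢ C j b → Adj S (C j a) y → Adj S (C j b) y
      nbr ma mb y≢b ay with mid-nbr∈clause ma ay
      ... | _ , refl = Adj-sym (adj-mid mb (y≢b ∘ cong (C _)))

    module _ (W : List (GV n m)) (res : Resolving W) where
      open DecMembership _≟_ using (_∈?_)

      one-leaf-member : ∀ {i a b} → LeafPair a b → X i a ∈ W → X i b ∉ W → TwoIn gadget W (inj₁ i)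
      one-leaf-member {i} {a} {b} lp xa∈W xb∉W with any? (_∈? W) (core i)
      ... | yes core∩W = let y , y∈core , y∈W = find core∩W in
        two y (X i a) (Adj⇒≢ (core-adj-leaf lp y∈core)) y∈W xa∈W (core-gadget y∈core) refl
      ... | no core∩W=∅ = ⊥-elim (x³≢xb (Resolving⇒separates res x³∉W xb∉W indistinguishable))
        where
        x³≢xb : X i f2 ≢ X i b
        x³≢xb = Adj⇒≢ (core-adj-leaf (LeafPair-sym lp) (there (there (here refl))))
        x³∉W : X i f2 ∉ W
        x³∉W x³∈W = core∩W=∅ (there (there (here x³∈W)))
        indistinguishable : ∀ {w} → w ∈ W →
                            ∀ c → HasDisjointPaths (X i f2) w c ⇔ HasDisjointPaths (X i b) w c
        indistinguishable {inj₂ _} _ = inner-⇔-outside x³ (other-leaf-inner lp) (λ ())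
        indistinguishable {inj₁ (i′ , c)} w∈W with i′ Fin.≟ i
        ... | no i′≢i = inner-⇔-outside x³ (other-leaf-inner lp) (i′≢i ∘ Sumₚ.inj₁-injective)
        ... | yes refl with var-vertex-cases lp c
        ...   | inj₁ c∈core      = ⊥-elim (core∩W=∅ (lose c∈core w∈W))
        ...   | inj₂ (inj₁ refl) = leaf-⇔ lp
        ...   | inj₂ (inj₂ refl) = ⊥-elim (xb∉W w∈W)

      var-two : ∀ i → TwoIn gadget W (inj₁ i)
      var-two i with X i f3 ∈? W | X i f4 ∈? W
      ... | yes x⁴∈W | yes x⁵∈W = two _ _ (λ ()) x⁴∈W x⁵∈W refl refl
      ... | yes x⁴∈W | no x⁵∉W  = one-leaf-member x⁴x⁵ x⁴∈W x⁵∉W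
      ... | no x⁴∉W  | yes x⁵∈W = one-leaf-member x⁵x⁴ x⁵∈W x⁴∉W
      ... | no x⁴∉W  | no x⁵∉W  = ⊥-elim (twins∉⇒¬Resolving (leaf-twins x⁴x⁵) x⁴∉W x⁵∉W res)

      clause-two : ∀ j → TwoIn gadget W (inj₂ j)
      clause-two j with C j f2 ∈? W | C j f3 ∈? W | C j f4 ∈? W
      ... | yes c³∈W | yes c⁴∈W | _        = two _ _ (λ ()) c³∈W c⁴∈W refl refl
      ... | yes c³∈W | no _     | yes c⁵∈W = two _ _ (λ ()) c³∈W c⁵∈W refl refl
      ... | no _     | yes c⁴∈W | yes c⁵∈W = two _ _ (λ ()) c⁴∈W c⁵∈W refl refl
      ... | yes _    | no c⁴∉W  | no c⁵∉W  =
          ⊥-elim (twins∉⇒¬Resolving (mid-twins c⁴ c⁵ (λ ())) c⁴∉W c⁵∉W res)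
      ... | no c³∉W  | yes _    | no c⁵∉W  =
          ⊥-elim (twins∉⇒¬Resolving (mid-twins c³ c⁵ (λ ())) c³∉W c⁵∉W res)
      ... | no c³∉W  | no c⁴∉W  | _        =
          ⊥-elim (twins∉⇒¬Resolving (mid-twins c³ c⁴ (λ ())) c³∉W c⁴∉W res)

      gadget-two : ∀ g → TwoIn gadget W g
      gadget-two (inj₁ i) = var-two i
      gadget-two (inj₂ j) = clause-two j

corollary4p4 : (n m : ℕ) (S : ThreeSAT n m) → EveryVarOccurs S →
    GraphNotions.Connected (Adj S) →
    (W : List (GV n m)) → Unique W → GraphNotions.Resolving (Adj S) W →
    2 * (m + n) ≤ length W
corollary4p4 n m S _ _ W _ res =
  two-per-class⇒≤ gadget W (⊎-comm _ _ ↔-∘ +↔⊎) (gadget-two S W res)
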